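{- Let $m\ge 2$, $s$, $\theta$, $n$, $r$ be positive integers. If $K_{m(n)}$ is not $r$-equitably $k$-colorable for some integer $k\ge m\big\lceil\frac{n}{\theta+r}\big\rceil$, then there is a positive integer $\theta'$ such that $\big\lfloor\frac{n}{\theta'+1}\big\rfloor<\big\lceil\frac{n}{\theta'+r}\big\rceil$, $\big\lceil\frac{n}{\theta'+r}\big\rceil=\big\lceil\frac{k}{m}\big\rceil$, and $\theta'<\theta$.
   Context: All graphs are finite, simple, undirected. For a positive integer $k$, a (proper) $k$-coloring of a graph $G$ is a map $f:V(G)\to\{1,\dots,k\}$ with $f(x)\ne f(y)$ whenever $xy\in E(G)$; its color classes are the sets $f^{ -1}(i)$, $i=1,\dots,k$. For a positive integer $r$, an $r$-equitable $k$-coloring is a $k$-coloring in which any two color classes differ in size by at most $r$; $G$ is $r$-equitably $k$-colorable if it has one. $K_{m(n)}$ denotes the complete $m$-partite graph with $n$ vertices in each part. -}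

module Defs where

open import Data.Nat using (ℕ; zero; suc; _+_; _*_; _≤_; _<_; NonZero)
open import Data.Nat.DivMod using (_/_)
open import Data.Fin using (Fin; toℕ)
open import Data.Fin.Properties using (_≟_)
open import Data.List using (List; length; filter; allFin)
open import Data.Product using (_×_)
open import Relation.Binary.PropositionalEquality using (_≡_)
open import Relation.Nullary using (¬_)
import Data.Empty

record Graph (N : ℕ) : Set₁ where
  field
    Adj     : Fin N → Fin N → Set
    sym     : ∀ {x y} → Adj x y → Adj y x
    irrefl  : ∀ {x} → ¬ Adj x x

open Graph public

-- Complete m-partite graph K_{m(n)}: vertex v ∈ Fin (m * n) lies in part ⌊v / n⌋,
-- so there are m parts of n vertices each; two vertices are adjacent iff their
-- parts differ.
part : (n : ℕ) → .{{NonZero n}} → ℕ → ℕ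
part n v = v / n

completeMultipartite : (m n : ℕ) → .{{NonZero n}} → Graph (m * n)
completeMultipartite m n = record
  { Adj    = λ x y → ¬ (part n (toℕ x) ≡ part n (toℕ y))
  ; sym    = λ p q → p (Relation.Binary.PropositionalEquality.sym q)
  ; irrefl = λ p → p Relation.Binary.PropositionalEquality.refl
  }

IsColoring : ∀ {N} → Graph N → (k : ℕ) → (Fin N → Fin k) → Set
IsColoring G k f = ∀ x y → Adj G x y → ¬ (f x ≡ f y)

classSize : ∀ {N k} → (Fin N → Fin k) → Fin k → ℕ
classSize {N} f i = length (filter (λ x → f x ≟ i) (allFin N))

IsREquitableColoring : ∀ {N} → ℕ → Graph N → (k : ℕ) → (Fin N → Fin k) → Set
IsREquitableColoring r G k f =
  IsColoring G k f × (∀ i j → classSize f i ≤ classSize f j + r)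

REquitablyColorable : ∀ {N} → ℕ → Graph N → ℕ → Set
REquitablyColorable r G k =
  Data.Product.∃ λ (f : Fin _ → Fin k) → IsREquitableColoring r G k f

-- ceiling division ⌈a / b⌉ (only used with b ≥ 1; by convention 0 when b = 0)
⌈_/_⌉ : ℕ → ℕ → ℕ
⌈ a / zero ⌉ = 0
⌈ a / suc b ⌉ = (a + b) / suc b

-- floor division ⌊a / b⌋ (only used with b ≥ 1; by convention 0 when b = 0)
⌊_/_⌋ : ℕ → ℕ → ℕ
⌊ a / zero ⌋ = 0
⌊ a / suc b ⌋ = a / suc b

K : (m n : ℕ) → Graph (m * n)
K m zero = record { Adj = λ _ _ → Data.Empty.⊥ ; sym = λ () ; irrefl = λ () }
K m (suc n) = completeMultipartite m (suc n)

-- Write q = ⌈k/m⌉ = p + 1 and L = ⌊n/q⌋, so that k = a q + b p with a + b = m. Cutting a parts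
-- of K_{m(n)} into q nearly equal blocks of consecutive vertices and the other b parts into p
-- such blocks, and giving every block its own colour, yields a proper k-colouring whose class
-- sizes lie between L and L + r, unless b > 0 and n > (L + r) p. In that case θ′ = L works:
-- n < (L + 1) q gives ⌊n/(L + 1)⌋ < q and ⌈n/(L + r)⌉ = q, while θ ≤ L would force
-- ⌈n/(θ + r)⌉ ≥ q and hence k ≥ m ⌈n/(θ + r)⌉ ≥ m q > k.
module Submission where

open import Defs using (K; IsColoring; classSize; REquitablyColorable; ⌈_/_⌉; ⌊_/_⌋)
open import Data.Bool using (if_then_else_)
open import Data.Nat using (ℕ; zero; suc; _+_; _*_; _∸_; _≤_; _<_; z≤n; s≤s; z<s; _<?_; _≤?_; NonZero; >-nonZero)
open import Data.Nat.Properties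
open import Data.Nat.DivMod using (_/_; _%_; m≡m%n+[m/n]*n; m%n<n; m/n*n≤m; m<n⇒m/n≡0; m/n≡1+[m∸n]/n; m<n*o⇒m/o<n)
open import Data.Nat.ListAction using (sum)
open import Data.Nat.ListAction.Properties using (sum-++)
open import Data.Nat.Tactic.RingSolver using (solve-∀)
open import Data.List using (List; []; _∷_; _++_; length; filter; tabulate; concat; replicate; lookup)
open import Data.List.Properties using (length-++; length-replicate; concat-++)
open import Data.List.Membership.Propositional.Properties using (∈-lookup)
open import Data.List.Relation.Unary.All as All using (All; []; _∷_)
open import Data.List.Relation.Unary.All.Properties using (++⁺; concat⁺; replicate⁺)
open import Data.Fin using (Fin; toℕ; fromℕ<)
import Data.Fin as Fin
open import Data.Fin.Properties using (toℕ-fromℕ<; toℕ<n; toℕ-injective)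
open import Data.Product using (∃; ∃₂; _×_; _,_; proj₁; proj₂)
open import Data.Sum using (_⊎_; inj₁; inj₂)
open import Data.Empty using (⊥-elim)
open import Function using (_∘_; id)
open import Relation.Binary.PropositionalEquality
open import Relation.Nullary using (¬_; yes; no; does; contradiction)
open import Relation.Nullary.Decidable using (dec-true; dec-false)

count : ℕ → (ℕ → ℕ) → ℕ → ℕ
count zero    g c = 0
count (suc N) g c = (if does (g 0 ≟ c) then 1 else 0) + count N (g ∘ suc) c

count-cong : ∀ N {g h : ℕ → ℕ} {c} → (∀ x → g x ≡ h x) → count N g c ≡ count N h c
count-cong zero    g≗h = refl
count-cong (suc N) {c = c} g≗h =
  cong₂ _+_ (cong (λ v → if does (v ≟ c) then 1 else 0) (g≗h 0)) (count-cong N (g≗h ∘ suc))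

count-++ : ∀ M N g c → count (M + N) g c ≡ count M g c + count N (λ y → g (M + y)) c
count-++ zero    N g c = refl
count-++ (suc M) N g c =
  trans (cong (δ +_) (count-++ M N (g ∘ suc) c)) (sym (+-assoc δ (count M (g ∘ suc) c) _))
  where δ = if does (g 0 ≟ c) then 1 else 0

count-all : ∀ N {g c} → (∀ {x} → x < N → g x ≡ c) → count N g c ≡ N
count-all zero    _    = refl
count-all (suc N) {g} {c} all rewrite dec-true (g 0 ≟ c) (all z<s) =
  cong suc (count-all N (all ∘ s≤s))

count-none : ∀ N {g c} → (∀ {x} → x < N → g x ≢ c) → count N g c ≡ 0
count-none zero    _    = refl
count-none (suc N) {g} {c} none rewrite dec-false (g 0 ≟ c) (none z<s) =
  count-none N (none ∘ s≤s)

count-suc : ∀ N g c → count N (suc ∘ g) (suc c) ≡ count N g c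
count-suc zero    g c = refl
count-suc (suc N) g c = cong (_ +_) (count-suc N (g ∘ suc) c)

count-tabulate : ∀ {N M k} (u : Fin N → Fin M) (f : Fin M → Fin k) (g : ℕ → ℕ) →
  (∀ x → toℕ (f (u x)) ≡ g (toℕ x)) →
  ∀ i → length (filter (λ y → f y Fin.≟ i) (tabulate u)) ≡ count N g (toℕ i)
count-tabulate {zero}  u f g f∘u≗g i = refl
count-tabulate {suc N} u f g f∘u≗g i with f (u Fin.zero) Fin.≟ i
... | yes eq rewrite dec-true (g 0 ≟ toℕ i) (trans (sym (f∘u≗g Fin.zero)) (cong toℕ eq)) =
  cong suc (count-tabulate (u ∘ Fin.suc) f (g ∘ suc) (f∘u≗g ∘ Fin.suc) i)
... | no ne rewrite dec-false (g 0 ≟ toℕ i) (ne ∘ toℕ-injective ∘ trans (f∘u≗g Fin.zero)) =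
  count-tabulate (u ∘ Fin.suc) f (g ∘ suc) (f∘u≗g ∘ Fin.suc) i

classSize≡count : ∀ {N k} (f : Fin N → Fin k) (g : ℕ → ℕ) →
  (∀ x → toℕ (f x) ≡ g (toℕ x)) → ∀ i → classSize f i ≡ count N g (toℕ i)
classSize≡count = count-tabulate id

-- The index of the block containing x when [0, sum B) is cut into consecutive blocks of the
-- sizes listed in B (junk value length B for x ≥ sum B).
block : List ℕ → ℕ → ℕ
block []      x = 0
block (b ∷ B) x with x <? b
... | yes _ = 0
... | no  _ = suc (block B (x ∸ b))

block-∷-< : ∀ {b} B {x} → x < b → block (b ∷ B) x ≡ 0
block-∷-< {b} B {x} x<b with x <? b
... | yes _   = refl
... | no  x≮b = contradiction x<b x≮b

block-∷-+ : ∀ b B y → block (b ∷ B) (b + y) ≡ suc (block B y)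
block-∷-+ b B y with b + y <? b
... | yes b+y<b = contradiction (m≤m+n b y) (<⇒≱ b+y<b)
... | no  _     = cong (suc ∘ block B) (m+n∸m≡n b y)

∸-<-sum : ∀ {b x S} → x < b + S → b ≤ x → x ∸ b < S
∸-<-sum {b} {x} {S} x<b+S b≤x = subst (x ∸ b <_) (m+n∸m≡n b S) (∸-monoˡ-< x<b+S b≤x)

block-< : ∀ B {x} → x < sum B → block B x < length B
block-< (b ∷ B) {x} x<sum with x <? b
... | yes _   = s≤s z≤n
... | no  x≮b = s≤s (block-< B (∸-<-sum x<sum (≮⇒≥ x≮b)))

block-++ˡ : ∀ B C {x} → x < sum B → block (B ++ C) x ≡ block B x
block-++ˡ (b ∷ B) C {x} x<sum with x <? b
... | yes _   = refl
... | no  x≮b = cong suc (block-++ˡ B C (∸-<-sum x<sum (≮⇒≥ x≮b)))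

block-++ʳ : ∀ B C {y} → sum B ≤ y → block (B ++ C) y ≡ length B + block C (y ∸ sum B)
block-++ʳ []      C _ = refl
block-++ʳ (b ∷ B) C {y} sum≤y with y <? b
... | yes y<b = contradiction (≤-trans (m≤m+n b (sum B)) sum≤y) (<⇒≱ y<b)
... | no  y≮b = cong suc (begin
  block (B ++ C) (y ∸ b)                    ≡⟨ block-++ʳ B C b+sum≤y ⟩
  length B + block C (y ∸ b ∸ sum B)
    ≡⟨ cong (λ z → length B + block C z) (∸-+-assoc y b (sum B)) ⟩
  length B + block C (y ∸ (b + sum B))      ∎)
  where
  open ≡-Reasoning
  b+sum≤y : sum B ≤ y ∸ b
  b+sum≤y = subst (_≤ y ∸ b) (m+n∸m≡n b (sum B)) (∸-monoˡ-≤ b sum≤y)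

count-block : ∀ B (i : Fin (length B)) → count (sum B) (block B) (toℕ i) ≡ lookup B i
count-block (b ∷ B) Fin.zero = begin
  count (b + sum B) (block (b ∷ B)) 0                                   ≡⟨ count-++ b (sum B) _ 0 ⟩
  count b (block (b ∷ B)) 0 + count (sum B) (block (b ∷ B) ∘ (b +_)) 0  ≡⟨ cong₂ _+_ inside outside ⟩
  b + 0                                                                 ≡⟨ +-identityʳ b ⟩
  b                                                                     ∎
  where
  open ≡-Reasoning
  inside : count b (block (b ∷ B)) 0 ≡ b
  inside = count-all b (block-∷-< B)
  outside : count (sum B) (block (b ∷ B) ∘ (b +_)) 0 ≡ 0
  outside = count-none (sum B) (λ {y} _ eq → 0≢1+n (trans (sym eq) (block-∷-+ b B y)))
count-block (b ∷ B) (Fin.suc i) = begin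
  count (b + sum B) (block (b ∷ B)) (suc (toℕ i))         ≡⟨ count-++ b (sum B) _ _ ⟩
  count b (block (b ∷ B)) (suc (toℕ i))
    + count (sum B) (block (b ∷ B) ∘ (b +_)) (suc (toℕ i))  ≡⟨ cong₂ _+_ inside outside ⟩
  0 + count (sum B) (suc ∘ block B) (suc (toℕ i))         ≡⟨ count-suc (sum B) (block B) (toℕ i) ⟩
  count (sum B) (block B) (toℕ i)                         ≡⟨ count-block B i ⟩
  lookup B i                                              ∎
  where
  open ≡-Reasoning
  inside : count b (block (b ∷ B)) (suc (toℕ i)) ≡ 0
  inside = count-none b (λ x<b eq → 0≢1+n (trans (sym (block-∷-< B x<b)) eq))
  outside : count (sum B) (block (b ∷ B) ∘ (b +_)) (suc (toℕ i))
          ≡ count (sum B) (suc ∘ block B) (suc (toℕ i))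
  outside = count-cong (sum B) (block-∷-+ b B)

Between : ℕ → ℕ → ℕ → Set
Between L U s = L ≤ s × s ≤ U

Splits : ℕ → (ℕ → Set) → List ℕ → Set
Splits n P B = sum B ≡ n × All P B

sum-concat : ∀ {n} Bs → All (λ B → sum B ≡ n) Bs → sum (concat Bs) ≡ length Bs * n
sum-concat []       []             = refl
sum-concat (B ∷ Bs) (sumB ∷ sums) =
  trans (sum-++ B (concat Bs)) (cong₂ _+_ sumB (sum-concat Bs sums))

block-++-≢ : ∀ B C {u v} → u < sum B → sum B ≤ v → block (B ++ C) u ≢ block (B ++ C) v
block-++-≢ B C {u} {v} u<sum sum≤v eq = <⇒≱ (block-< B u<sum) (begin
  length B                                ≤⟨ m≤m+n (length B) _ ⟩
  length B + block C (v ∸ sum B)          ≡⟨ sym (block-++ʳ B C sum≤v) ⟩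
  block (B ++ C) v                        ≡⟨ sym eq ⟩
  block (B ++ C) u                        ≡⟨ block-++ˡ B C u<sum ⟩
  block B u                               ∎)
  where open ≤-Reasoning

block-concat-/ : ∀ {d} .{{_ : NonZero d}} Bs → All (λ B → sum B ≡ d) Bs → ∀ {x y} →
  x < length Bs * d → y < length Bs * d →
  block (concat Bs) x ≡ block (concat Bs) y → x / d ≡ y / d
block-concat-/ (B ∷ Bs) (refl ∷ sums) {x} {y} x< y< same with x <? sum B | y <? sum B
... | yes x<sum | yes y<sum = trans (m<n⇒m/n≡0 x<sum) (sym (m<n⇒m/n≡0 y<sum))
... | yes x<sum | no  y≮sum = contradiction same (block-++-≢ B (concat Bs) x<sum (≮⇒≥ y≮sum))
... | no  x≮sum | yes y<sum = contradiction (sym same) (block-++-≢ B (concat Bs) y<sum (≮⇒≥ x≮sum))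
... | no  x≮sum | no  y≮sum = begin
  x / sum B                     ≡⟨ m/n≡1+[m∸n]/n (≮⇒≥ x≮sum) ⟩
  suc ((x ∸ sum B) / sum B)
    ≡⟨ cong suc (block-concat-/ Bs sums (∸-<-sum x< (≮⇒≥ x≮sum)) (∸-<-sum y< (≮⇒≥ y≮sum)) later) ⟩
  suc ((y ∸ sum B) / sum B)     ≡⟨ sym (m/n≡1+[m∸n]/n (≮⇒≥ y≮sum)) ⟩
  y / sum B                     ∎
  where
  open ≡-Reasoning
  later : block (concat Bs) (x ∸ sum B) ≡ block (concat Bs) (y ∸ sum B)
  later = +-cancelˡ-≡ (length B) _ _ (begin
    length B + block (concat Bs) (x ∸ sum B)   ≡⟨ sym (block-++ʳ B (concat Bs) (≮⇒≥ x≮sum)) ⟩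
    block (concat (B ∷ Bs)) x                  ≡⟨ same ⟩
    block (concat (B ∷ Bs)) y                  ≡⟨ block-++ʳ B (concat Bs) (≮⇒≥ y≮sum) ⟩
    length B + block (concat Bs) (y ∸ sum B)   ∎)

multipartiteColoring : ∀ {n L r} (Bs : List (List ℕ)) → All (Splits (suc n) (Between L (L + r))) Bs →
  REquitablyColorable r (K (length Bs) (suc n)) (length (concat Bs))
multipartiteColoring {n} {L} {r} Bs splits = colour , proper , equitable
  where
  C : List ℕ
  C = concat Bs
  sums : All (λ B → sum B ≡ suc n) Bs
  sums = All.map proj₁ splits
  sizes : All (Between L (L + r)) C
  sizes = concat⁺ (All.map proj₂ splits)
  vertex< : ∀ (x : Fin (length Bs * suc n)) → toℕ x < sum C
  vertex< x = subst (toℕ x <_) (sym (sum-concat Bs sums)) (toℕ<n x)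
  colour : Fin (length Bs * suc n) → Fin (length C)
  colour x = fromℕ< (block-< C (vertex< x))
  colour≗block : ∀ x → toℕ (colour x) ≡ block C (toℕ x)
  colour≗block x = toℕ-fromℕ< _
  proper : IsColoring (K (length Bs) (suc n)) (length C) colour
  proper x y differentParts sameColour = differentParts (block-concat-/ Bs sums (toℕ<n x) (toℕ<n y)
    (trans (sym (colour≗block x)) (trans (cong toℕ sameColour) (colour≗block y))))
  classSize≡lookup : ∀ i → classSize colour i ≡ lookup C i
  classSize≡lookup i = begin
    classSize colour i
      ≡⟨ classSize≡count colour (block C) colour≗block i ⟩
    count (length Bs * suc n) (block C) (toℕ i)
      ≡⟨ cong (λ N → count N (block C) (toℕ i)) (sym (sum-concat Bs sums)) ⟩
    count (sum C) (block C) (toℕ i)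
      ≡⟨ count-block C i ⟩
    lookup C i
      ∎
    where open ≡-Reasoning
  classBetween : ∀ i → Between L (L + r) (classSize colour i)
  classBetween i = subst (Between L (L + r)) (sym (classSize≡lookup i)) (All.lookup sizes (∈-lookup i))
  equitable : ∀ i j → classSize colour i ≤ classSize colour j + r
  equitable i j = ≤-trans (proj₂ (classBetween i)) (+-monoˡ-≤ r (proj₁ (classBetween j)))

m<[1+m/n]*n : ∀ m n .{{_ : NonZero n}} → m < suc (m / n) * n
m<[1+m/n]*n m n = begin-strict
  m                   ≡⟨ m≡m%n+[m/n]*n m n ⟩
  m % n + m / n * n   <⟨ +-monoˡ-< (m / n * n) (m%n<n m n) ⟩
  n + m / n * n       ∎
  where open ≤-Reasoning

m≤⌈m/n⌉*n : ∀ m n → m ≤ ⌈ m / suc n ⌉ * suc n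
m≤⌈m/n⌉*n m n = +-cancelʳ-≤ (suc n) m _ (begin
  m + suc n                                 ≡⟨ +-suc m n ⟩
  suc (m + n)                               ≤⟨ m<[1+m/n]*n (m + n) (suc n) ⟩
  suc n + ⌈ m / suc n ⌉ * suc n             ≡⟨ +-comm (suc n) _ ⟩
  ⌈ m / suc n ⌉ * suc n + suc n             ∎)
  where open ≤-Reasoning

m≤o*n⇒⌈m/n⌉≤o : ∀ {m n o} → m ≤ o * suc n → ⌈ m / suc n ⌉ ≤ o
m≤o*n⇒⌈m/n⌉≤o {m} {n} {o} m≤o*n = m<1+n⇒m≤n (m<n*o⇒m/o<n (begin-strict
  m + n                 <⟨ +-monoʳ-< m (n<1+n n) ⟩
  m + suc n             ≤⟨ +-monoˡ-≤ (suc n) m≤o*n ⟩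
  o * suc n + suc n     ≡⟨ +-comm (o * suc n) (suc n) ⟩
  suc o * suc n         ∎))
  where open ≤-Reasoning

o*n<m⇒o<⌈m/n⌉ : ∀ {m n o} → o * suc n < m → o < ⌈ m / suc n ⌉
o*n<m⇒o<⌈m/n⌉ {m} {n} {o} o*n<m = ≰⇒> λ ⌈m/n⌉≤o →
  <⇒≱ o*n<m (≤-trans (m≤⌈m/n⌉*n m n) (*-monoˡ-≤ (suc n) ⌈m/n⌉≤o))

⌈m/n⌉≡1+o : ∀ {m n o} → o * suc n < m → m ≤ suc o * suc n → ⌈ m / suc n ⌉ ≡ suc o
⌈m/n⌉≡1+o o*n<m m≤[1+o]*n = ≤-antisym (m≤o*n⇒⌈m/n⌉≤o m≤[1+o]*n) (o*n<m⇒o<⌈m/n⌉ o*n<m)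

0<m*⌈n/d⌉ : ∀ m {n} d .{{_ : NonZero m}} → 0 < n → 0 < m * ⌈ n / suc d ⌉
0<m*⌈n/d⌉ m d 0<n = ≤-trans (o*n<m⇒o<⌈m/n⌉ {o = 0} 0<n) (m≤n*m _ m)

⌈m/n⌉-bracket : ∀ {m} n → 0 < m → ∃ λ o → ⌈ m / suc n ⌉ ≡ suc o × o * suc n < m × m ≤ suc o * suc n
⌈m/n⌉-bracket {m} n 0<m with ⌈ m / suc n ⌉ in eq
... | zero  = contradiction (subst (λ c → m ≤ c * suc n) eq (m≤⌈m/n⌉*n m n)) (<⇒≱ 0<m)
... | suc o = o , refl , o*n<m , subst (λ c → m ≤ c * suc n) eq (m≤⌈m/n⌉*n m n)
  where
  o*n<m : o * suc n < m
  o*n<m = ≰⇒> λ m≤o*n → <⇒≱ (n<1+n o) (subst (_≤ o) eq (m≤o*n⇒⌈m/n⌉≤o m≤o*n))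

evenSplit : ℕ → ℕ → List ℕ
evenSplit n zero        = []
evenSplit n t@(suc _)   = replicate (n % t) (suc (n / t)) ++ replicate (t ∸ n % t) (n / t)

length-evenSplit : ∀ n t → length (evenSplit n t) ≡ t
length-evenSplit n zero        = refl
length-evenSplit n t@(suc _)   = begin
  length (evenSplit n t)      ≡⟨ length-++ (replicate (n % t) _) ⟩
  length (replicate (n % t) _) + length (replicate (t ∸ n % t) (n / t))
                              ≡⟨ cong₂ _+_ (length-replicate (n % t)) (length-replicate (t ∸ n % t)) ⟩
  n % t + (t ∸ n % t)         ≡⟨ m+[n∸m]≡n (<⇒≤ (m%n<n n t)) ⟩
  t                           ∎
  where open ≡-Reasoning

sum-replicate : ∀ c x → sum (replicate c x) ≡ c * x
sum-replicate zero    x = refl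
sum-replicate (suc c) x = cong (x +_) (sum-replicate c x)

sum-evenSplit : ∀ n t → sum (evenSplit n (suc t)) ≡ n
sum-evenSplit n t = begin
  sum (evenSplit n q)                   ≡⟨ sum-++ (replicate ρ (suc a)) _ ⟩
  sum (replicate ρ (suc a)) + sum (replicate (q ∸ ρ) a)
                                        ≡⟨ cong₂ _+_ (sum-replicate ρ (suc a)) (sum-replicate (q ∸ ρ) a) ⟩
  ρ * suc a + (q ∸ ρ) * a               ≡⟨ regroup ρ a (q ∸ ρ) ⟩
  ρ + a * (ρ + (q ∸ ρ))                 ≡⟨ cong (λ s → ρ + a * s) (m+[n∸m]≡n (<⇒≤ (m%n<n n q))) ⟩
  ρ + a * q                             ≡⟨ sym (m≡m%n+[m/n]*n n q) ⟩
  n                                     ∎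
  where
  open ≡-Reasoning
  q = suc t
  a = n / q
  ρ = n % q
  regroup : ∀ ρ a δ → ρ * suc a + δ * a ≡ ρ + a * (ρ + δ)
  regroup = solve-∀

evenSplit-between : ∀ {n L U} t → L * suc t ≤ n → n ≤ U * suc t →
  All (Between L U) (evenSplit n (suc t))
evenSplit-between {n} {L} {U} t L*q≤n n≤U*q =
  ++⁺ (larger (n % q) (λ 0<ρ → L≤a′ , a<U 0<ρ)) (replicate⁺ (q ∸ n % q) (L≤a , a≤U))
  where
  q = suc t
  a = n / q
  L≤a : L ≤ a
  L≤a = ≮⇒≥ (λ a<L → <⇒≱ (m<[1+m/n]*n n q) (≤-trans (*-monoˡ-≤ q a<L) L*q≤n))
  L≤a′ : L ≤ suc a
  L≤a′ = ≤-trans L≤a (n≤1+n a)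
  a≤U : a ≤ U
  a≤U = *-cancelʳ-≤ a U q (≤-trans (m/n*n≤m n q) n≤U*q)
  a<U : 0 < n % q → suc a ≤ U
  a<U 0<ρ = *-cancelʳ-< q a U (<-≤-trans a*q<n n≤U*q)
    where
    a*q<n : a * q < n
    a*q<n = subst (a * q <_) (sym (m≡m%n+[m/n]*n n q)) (m<n+m (a * q) 0<ρ)
  larger : ∀ ρ → (0 < ρ → Between L U (suc a)) → All (Between L U) (replicate ρ (suc a))
  larger zero    _       = []
  larger (suc ρ) between = replicate⁺ (suc ρ) (between z<s)

evenSplit-splits : ∀ {n L U} t → L * t ≤ n → n ≤ U * t → Splits n (Between L U) (evenSplit n t)
evenSplit-splits {n} {L} {U} zero _ n≤U*0 = sym (n≤0⇒n≡0 (subst (n ≤_) (*-zeroʳ U) n≤U*0)) , []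
evenSplit-splits {n} (suc t) L*q≤n n≤U*q = sum-evenSplit n t , evenSplit-between t L*q≤n n≤U*q

length-concat-replicate : ∀ c (B : List ℕ) → length (concat (replicate c B)) ≡ c * length B
length-concat-replicate zero    B = refl
length-concat-replicate (suc c) B =
  trans (length-++ B) (cong (length B +_) (length-concat-replicate c B))

twoSizeColoring : ∀ {n r} a b p → 0 < r → (b ≡ 0 ⊎ suc n ≤ (suc n / suc p + r) * p) →
  REquitablyColorable r (K (a + b) (suc n)) (a * suc p + b * p)
twoSizeColoring {n} {r} a b p 0<r cond =
  subst₂ (λ m k → REquitablyColorable r (K m N) k) parts colours (multipartiteColoring Bs splits)
  where
  N q L : ℕ
  N = suc n
  q = suc p
  L = N / q
  upper lower : List ℕ
  upper = evenSplit N q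
  lower = evenSplit N p
  Bs : List (List ℕ)
  Bs = replicate a upper ++ replicate b lower
  parts : length Bs ≡ a + b
  parts = trans (length-++ (replicate a upper)) (cong₂ _+_ (length-replicate a) (length-replicate b))
  colours : length (concat Bs) ≡ a * q + b * p
  colours = begin
    length (concat Bs)
      ≡⟨ cong length (sym (concat-++ (replicate a upper) (replicate b lower))) ⟩
    length (concat (replicate a upper) ++ concat (replicate b lower))
      ≡⟨ length-++ (concat (replicate a upper)) ⟩
    length (concat (replicate a upper)) + length (concat (replicate b lower))
      ≡⟨ cong₂ _+_ (length-concat-replicate a upper) (length-concat-replicate b lower) ⟩
    a * length upper + b * length lower
      ≡⟨ cong₂ (λ x y → a * x + b * y) (length-evenSplit N q) (length-evenSplit N p) ⟩
    a * q + b * p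
      ∎
    where open ≡-Reasoning
  1+L≤L+r : suc L ≤ L + r
  1+L≤L+r = subst (_≤ L + r) (+-comm L 1) (+-monoʳ-≤ L 0<r)
  upperSplits : Splits N (Between L (L + r)) upper
  upperSplits = evenSplit-splits q (m/n*n≤m N q)
    (≤-trans (<⇒≤ (m<[1+m/n]*n N q)) (*-monoˡ-≤ q 1+L≤L+r))
  lowerSplits : (b ≡ 0 ⊎ N ≤ (L + r) * p) → All (Splits N (Between L (L + r))) (replicate b lower)
  lowerSplits (inj₁ b≡0) =
    subst (λ c → All (Splits N (Between L (L + r))) (replicate c lower)) (sym b≡0) []
  lowerSplits (inj₂ N≤)  =
    replicate⁺ b (evenSplit-splits p (≤-trans (*-monoʳ-≤ L (n≤1+n p)) (m/n*n≤m N q)) N≤)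
  splits : All (Splits N (Between L (L + r))) Bs
  splits = ++⁺ (replicate⁺ a upperSplits) (lowerSplits cond)

quotientSplit : ∀ {m p k} → p * m ≤ k → k ≤ suc p * m → ∃₂ λ a b → a + b ≡ m × a * suc p + b * p ≡ k
quotientSplit {m} {p} {k} pm≤k k≤qm = a , m ∸ a , m+[n∸m]≡n a≤m , (begin
  a * suc p + (m ∸ a) * p       ≡⟨ regroup a (m ∸ a) p ⟩
  a + (a + (m ∸ a)) * p         ≡⟨ cong (λ s → a + s * p) (m+[n∸m]≡n a≤m) ⟩
  a + m * p                     ≡⟨ cong (a +_) (*-comm m p) ⟩
  k ∸ p * m + p * m             ≡⟨ m∸n+n≡m pm≤k ⟩
  k                             ∎)
  where
  open ≡-Reasoning
  a : ℕ
  a = k ∸ p * m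
  a≤m : a ≤ m
  a≤m = subst (a ≤_) (m+n∸n≡m m (p * m)) (∸-monoˡ-≤ (p * m) k≤qm)
  regroup : ∀ a b p → a * suc p + b * p ≡ a + (a + b) * p
  regroup = solve-∀

equitableColoring : ∀ {m n r k p} → 0 < r → p * m ≤ k → k ≤ suc p * m →
  (k ≡ suc p * m ⊎ suc n ≤ (suc n / suc p + r) * p) → REquitablyColorable r (K m (suc n)) k
equitableColoring {m} {n} {r} {k} {p} 0<r _ _ (inj₁ refl) =
  subst₂ (λ m′ k′ → REquitablyColorable r (K m′ (suc n)) k′)
    (+-identityʳ m) (trans (+-identityʳ (m * suc p)) (*-comm m (suc p)))
    (twoSizeColoring m 0 p 0<r (inj₁ refl))
equitableColoring {m} {n} {r} {k} {p} 0<r pm≤k k≤qm (inj₂ n≤) with quotientSplit pm≤k k≤qm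
... | a , b , a+b≡m , colours≡k =
  subst₂ (λ m′ k′ → REquitablyColorable r (K m′ (suc n)) k′) a+b≡m colours≡k
    (twoSizeColoring a b p 0<r (inj₂ n≤))

threshold-witness : ∀ {n r p L} → 0 < r → n < suc L * suc p → (L + r) * p < n →
  1 ≤ L × ⌊ n / L + 1 ⌋ < suc p × ⌈ n / L + r ⌉ ≡ suc p
threshold-witness {n} {r} {p} {zero} 0<r n<q rp<n =
  contradiction (m<1+n⇒m≤n (subst (n <_) (+-identityʳ (suc p)) n<q)) (<⇒≱ (≤-<-trans (m≤n*m p r) rp<n))
  where instance _ = >-nonZero 0<r
threshold-witness {n} {r} {p} {suc L} 0<r n<[2+L]q [L+r]p<n = s≤s z≤n , ⌊n/[L+1]⌋<q , ⌈n/[L+r]⌉≡q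
  where
  ⌊n/[L+1]⌋<q : ⌊ n / suc L + 1 ⌋ < suc p
  ⌊n/[L+1]⌋<q = m<n*o⇒m/o<n (subst (n <_) [2+L]q≡q[L+1+1] n<[2+L]q)
    where
    [2+L]q≡q[L+1+1] : (2 + L) * suc p ≡ suc p * suc (L + 1)
    [2+L]q≡q[L+1+1] = trans (*-comm (2 + L) (suc p)) (cong (λ z → suc p * suc z) (+-comm 1 L))
  ⌈n/[L+r]⌉≡q : ⌈ n / suc L + r ⌉ ≡ suc p
  ⌈n/[L+r]⌉≡q = ⌈m/n⌉≡1+o (subst (_< n) (*-comm (suc L + r) p) [L+r]p<n) (begin
    n                     ≤⟨ <⇒≤ n<[2+L]q ⟩
    (2 + L) * suc p       ≤⟨ *-monoˡ-≤ (suc p) (s≤s (m<m+n L 0<r)) ⟩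
    (suc L + r) * suc p   ≡⟨ *-comm (suc L + r) (suc p) ⟩
    suc p * (suc L + r)   ∎)
    where open ≤-Reasoning

witness<θ : ∀ {m n r k p θ L} → m * ⌈ n / suc θ + r ⌉ ≤ k → k < suc p * m →
  (L + r) * p < n → L < suc θ
witness<θ {m} {n} {r} {k} {p} {θ} {L} m⌈⌉≤k k<qm [L+r]p<n = ≰⇒> λ 1+θ≤L → <⇒≱ k<qm (begin
  suc p * m                     ≤⟨ *-monoˡ-≤ m (o*n<m⇒o<⌈m/n⌉ {o = p} (p[θ+r]<n 1+θ≤L)) ⟩
  ⌈ n / suc θ + r ⌉ * m         ≡⟨ *-comm _ m ⟩
  m * ⌈ n / suc θ + r ⌉         ≤⟨ m⌈⌉≤k ⟩
  k                             ∎)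
  where
  open ≤-Reasoning
  p[θ+r]<n : suc θ ≤ L → p * (suc θ + r) < n
  p[θ+r]<n 1+θ≤L = begin-strict
    p * (suc θ + r)     ≡⟨ *-comm p (suc θ + r) ⟩
    (suc θ + r) * p     ≤⟨ *-monoˡ-≤ p (+-monoˡ-≤ r 1+θ≤L) ⟩
    (L + r) * p         <⟨ [L+r]p<n ⟩
    n                   ∎

lemma13 : (m s θ n r k : ℕ) → 2 ≤ m → 1 ≤ s → 1 ≤ θ → 1 ≤ n → 1 ≤ r →
    m * ⌈ n / θ + r ⌉ ≤ k →
    ¬ REquitablyColorable r (K m n) k →
    ∃ λ θ′ → 1 ≤ θ′ × ⌊ n / θ′ + 1 ⌋ < ⌈ n / θ′ + r ⌉
    × ⌈ n / θ′ + r ⌉ ≡ ⌈ k / m ⌉ × θ′ < θ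
lemma13 m@(suc m′) _ (suc θ) n@(suc _) r k _ _ _ _ 0<r m⌈⌉≤k ¬colourable
  with ⌈m/n⌉-bracket {k} m′ (<-≤-trans (0<m*⌈n/d⌉ m {n} (θ + r) z<s) m⌈⌉≤k)
... | p , ⌈k/m⌉≡q , pm<k , k≤qm with k <? suc p * m | n ≤? (n / suc p + r) * p
...   | no k≮qm | _      =
  ⊥-elim (¬colourable (equitableColoring {p = p} 0<r (<⇒≤ pm<k) k≤qm (inj₁ (≤-antisym k≤qm (≮⇒≥ k≮qm)))))
...   | yes _   | yes n≤ =
  ⊥-elim (¬colourable (equitableColoring {p = p} 0<r (<⇒≤ pm<k) k≤qm (inj₂ n≤)))
...   | yes k<qm | no n≰ with threshold-witness 0<r (m<[1+m/n]*n n (suc p)) (≰⇒> n≰)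
...     | 1≤L , ⌊⌋<q , ⌈⌉≡q =
  n / suc p , 1≤L , subst (⌊ n / (n / suc p) + 1 ⌋ <_) (sym ⌈⌉≡q) ⌊⌋<q , trans ⌈⌉≡q (sym ⌈k/m⌉≡q) ,
  witness<θ {p = p} m⌈⌉≤k k<qm (≰⇒> n≰)
lemma13 zero    _ _       _    _ _ ()
lemma13 (suc _) _ zero    _    _ _ _ _ ()
lemma13 (suc _) _ (suc _) zero _ _ _ _ _ ()
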